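{- There is exactly one positive integer $m$ such that $t(m)=t(5)$, $t(m+1)=t(6)$ and $t(m+2)=t(7)$ (namely $m=5$). Equivalently, there is exactly one triple of consecutive integers of the form $(p,qr,s)$ with $p,q,r,s$ primes and $q\neq r$.
   Context: For each positive integer $n$, define a finite ordered (planar) rooted tree $t(n)$ recursively: $t(1)$ is the tree consisting of a single root vertex; if $n>1$ has prime factorization $n=p_1^{n_1}\cdots p_k^{n_k}$ with primes $p_1<\dots<p_k$ and exponents $n_i\ge 1$, then $t(n)$ is the ordered rooted tree whose root has exactly $k$ children, ordered from left to right, where the subtree rooted at the $i$-th child is $t(n_i)$. Trees are compared as ordered rooted trees (up to isomorphism preserving root and the left-to-right order of children). Thus $t(m)=t(5)$ iff $m$ is prime, and $t(m)=t(6)$ iff $m$ is a product of two distinct primes. -}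

module Defs where

open import Data.Nat using (ℕ; zero; suc; _/_)
open import Data.Nat.Divisibility using (_∣?_)
open import Data.Nat.Primality using (prime?)
open import Data.List using (List; []; _∷_; map; upTo)
open import Relation.Nullary using (yes; no)

data Tree : Set where
  node : List Tree → Tree

-- Multiplicity (p-adic valuation) of d ≥ 2 in n, by repeated division.
-- The fuel argument bounds the number of divisions (fuel = n suffices).
valuation : ℕ → ℕ → ℕ → ℕ
valuation zero    k n = 0
valuation (suc f) k zero = 0
valuation (suc f) k n@(suc _) with (suc (suc k)) ∣? n
... | yes _ = suc (valuation f k (n / suc (suc k)))
... | no  _ = 0

-- Exponents of the prime factorization of n, listed by increasing prime:
-- scan candidates d = k+2 for k = 0 … n-1 (i.e. d = 2 … n+1), keep primes dividing n.
exponentsFrom : ℕ → List ℕ → List ℕ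
exponentsFrom n [] = []
exponentsFrom n (k ∷ ks) with prime? (suc (suc k)) | (suc (suc k)) ∣? n
... | yes _ | yes _ = valuation n k n ∷ exponentsFrom n ks
... | _     | _     = exponentsFrom n ks

exponents : ℕ → List ℕ
exponents n = exponentsFrom n (upTo n)

-- t with fuel; the fuel n suffices since every exponent n_i of n > 1 is < n.
tF : ℕ → ℕ → Tree
tF zero    n = node []
tF (suc f) n = node (map (tF f) (exponents n))

-- t(n): root has one child per prime divisor (in increasing order), the i-th
-- subtree being t(n_i). t(1) = single vertex (exponents 1 = []).
t : ℕ → Tree
t n = tF n n

-- t(n) = t(5) says that n has exactly one prime divisor, with exponent 1, and
-- t(n) = t(6) that n is squarefree with exactly two prime divisors.  Both are used
-- only through one principle: a squarefree n equals any divisor d of n that every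
-- prime divisor of n divides.  Hence m and m + 2 are equal to each of their prime
-- divisors and m + 1 equals 6 as soon as 6 divides it.  Running through m mod 6,
-- a factor 2 or 3 of m or m + 2 pins m to 1, 2 or 3, where t(m) or t(m + 1) has
-- the wrong shape, and otherwise 6 divides m + 1, so m + 1 = 6.

module Submission where

open import Defs
open import Data.Nat using (ℕ; zero; suc; 2+; _<_; _≤_; _+_; _*_; _^_; _∸_; _%_; _/_; z≤n; s≤s; NonZero; >-nonZero; ≢-nonZero⁻¹)
open import Data.Nat.Properties using (+-comm; *-identityˡ; *-identityʳ; suc-injective; ≤-trans; n≤1+n; <⇒≢)
open import Data.Nat.Divisibility
open import Data.Nat.DivMod using (m≡m%n+[m/n]*n; m%n<n; m≥n⇒m/n>0)
open import Data.Nat.Primality using (Prime; prime?; prime[2]; ¬prime[0]; ¬prime[1])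
open import Data.Nat.Primality.Factorisation using (factorise)
open import Data.List using (List; []; _∷_; map; filter; upTo; length)
open import Data.List.Properties using (length-map; map-∘; filter-accept; filter-reject)
open import Data.List.Membership.Propositional using (_∈_)
open import Data.List.Membership.Propositional.Properties using (∈-map⁺; ∈-filter⁺; ∈-upTo⁺)
open import Data.List.Relation.Unary.Any using (here; there)
open import Data.List.Relation.Unary.All as All using (All; []; _∷_)
open import Data.Product using (_×_; _,_; ∃)
open import Data.Sum using (_⊎_; inj₁; inj₂)
open import Function using (_∘_)
open import Function.Bundles using (_⇔_; mk⇔)
open import Relation.Nullary using (Dec; yes; no; ¬_; contradiction; _×-dec_; from-yes)
open import Relation.Binary.PropositionalEquality

SquareFree : ℕ → Set
SquareFree n = ∀ {p} → Prime p → ¬ (p * p ∣ n)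

∃primeDivisor : ∀ {n} → 2 ≤ n → ∃ λ p → Prime p × p ∣ n
∃primeDivisor {n@(suc _)} n≥2 with factorise n
... | record { factors = [] ; isFactorisation = n≡1 } = contradiction (sym n≡1) (<⇒≢ n≥2)
... | record { factors = p ∷ ps ; isFactorisation = n≡p*ps ; factorsPrime = pp ∷ _ } =
  p , pp , subst (p ∣_) (sym n≡p*ps) (m∣m*n _)

squareFree∧∣⇒≡ : ∀ {n d} .{{_ : NonZero n}} → SquareFree n → d ∣ n →
                 (∀ {q} → Prime q → q ∣ n → q ∣ d) → n ≡ d
squareFree∧∣⇒≡ {n} _ (divides 0 n≡0) _ = contradiction n≡0 (≢-nonZero⁻¹ n)
squareFree∧∣⇒≡ {d = d} _ (divides 1 n≡d) _ = trans n≡d (*-identityˡ d)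
squareFree∧∣⇒≡ {d = d} sf (divides c@(2+ _) n≡c*d) primes∣d with ∃primeDivisor {c} (s≤s (s≤s z≤n))
... | q , pq , q∣c =
  contradiction (subst (q * q ∣_) (sym n≡c*d) (*-pres-∣ q∣c (primes∣d pq q∣n))) (sf pq)
  where
  q∣n = subst (q ∣_) (sym n≡c*d) (∣-trans q∣c (m∣m*n d))

≡residue⇒∣ : ∀ {d m n} r q → m ≡ r + q * n → d ∣ r → d ∣ n → d ∣ m
≡residue⇒∣ _ q refl d∣r d∣n = ∣m∣n⇒∣m+n d∣r (∣-trans d∣n (n∣m*n q))

^∣⇒≤valuation : ∀ {f k n j} .{{_ : NonZero n}} → j ≤ f → (2 + k) ^ j ∣ n → j ≤ valuation f k n
^∣⇒≤valuation {j = zero} _ _ = z≤n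
^∣⇒≤valuation {suc f} {k} {n@(suc _)} {suc j} (s≤s j≤f) pʲ⁺¹∣n with 2 + k ∣? n
... | yes p∣n = s≤s (^∣⇒≤valuation {{>-nonZero (m≥n⇒m/n>0 (∣⇒≤ p∣n))}} j≤f
                                    (m*n∣o⇒n∣o/m (2 + k) ((2 + k) ^ j) pʲ⁺¹∣n))
... | no p∤n = contradiction (∣-trans (m∣m*n ((2 + k) ^ j)) pʲ⁺¹∣n) p∤n

primeDivisorIndex? : ∀ n k → Dec (Prime (2 + k) × 2 + k ∣ n)
primeDivisorIndex? n k = prime? (2 + k) ×-dec 2 + k ∣? n

primeDivisors : ℕ → List ℕ
primeDivisors n = map (2 +_) (filter (primeDivisorIndex? n) (upTo n))

multiplicity : ℕ → ℕ → ℕ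
multiplicity n p = valuation n (p ∸ 2) n

exponentsFrom-accept : ∀ {n k} ks → Prime (2 + k) × 2 + k ∣ n →
                       exponentsFrom n (k ∷ ks) ≡ valuation n k n ∷ exponentsFrom n ks
exponentsFrom-accept {n} {k} _ (pp , p∣n) with prime? (2 + k) | 2 + k ∣? n
... | yes _ | yes _ = refl
... | yes _ | no p∤n = contradiction p∣n p∤n
... | no ¬pp | _ = contradiction pp ¬pp

exponentsFrom-reject : ∀ {n k} ks → ¬ (Prime (2 + k) × 2 + k ∣ n) →
                       exponentsFrom n (k ∷ ks) ≡ exponentsFrom n ks
exponentsFrom-reject {n} {k} _ ¬pd with prime? (2 + k) | 2 + k ∣? n
... | yes pp | yes p∣n = contradiction (pp , p∣n) ¬pd
... | yes _ | no _ = refl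
... | no _ | _ = refl

exponentsFrom≡ : ∀ n ks →
  exponentsFrom n ks ≡ map (λ k → valuation n k n) (filter (primeDivisorIndex? n) ks)
exponentsFrom≡ n [] = refl
exponentsFrom≡ n (k ∷ ks) with primeDivisorIndex? n k
... | yes pd = begin
  exponentsFrom n (k ∷ ks)                       ≡⟨ exponentsFrom-accept ks pd ⟩
  valuation n k n ∷ exponentsFrom n ks           ≡⟨ cong (_ ∷_) (exponentsFrom≡ n ks) ⟩
  map _ (k ∷ filter (primeDivisorIndex? n) ks) ≡⟨ cong (map _) (filter-accept (primeDivisorIndex? n) pd) ⟨
  map _ (filter (primeDivisorIndex? n) (k ∷ ks)) ∎
  where open ≡-Reasoning
... | no ¬pd = begin
  exponentsFrom n (k ∷ ks)                       ≡⟨ exponentsFrom-reject ks ¬pd ⟩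
  exponentsFrom n ks                             ≡⟨ exponentsFrom≡ n ks ⟩
  map _ (filter (primeDivisorIndex? n) ks)   ≡⟨ cong (map _) (filter-reject (primeDivisorIndex? n) ¬pd) ⟨
  map _ (filter (primeDivisorIndex? n) (k ∷ ks)) ∎
  where open ≡-Reasoning

exponents≡map-multiplicity : ∀ n → exponents n ≡ map (multiplicity n) (primeDivisors n)
exponents≡map-multiplicity n = trans (exponentsFrom≡ n (upTo n)) (map-∘ _)

∈-primeDivisors : ∀ {n p} .{{_ : NonZero n}} → Prime p → p ∣ n → p ∈ primeDivisors n
∈-primeDivisors {p = 0} pp _ = contradiction pp ¬prime[0]
∈-primeDivisors {p = 1} pp _ = contradiction pp ¬prime[1]
∈-primeDivisors {n} {2+ k} pp p∣n =
  ∈-map⁺ (2 +_) (∈-filter⁺ (primeDivisorIndex? n) (∈-upTo⁺ (≤-trans (n≤1+n _) (∣⇒≤ p∣n))) (pp , p∣n))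

∈-exponents : ∀ {n p} .{{_ : NonZero n}} → Prime p → p ∣ n → multiplicity n p ∈ exponents n
∈-exponents {n} {p} pp p∣n =
  subst (multiplicity n p ∈_) (sym (exponents≡map-multiplicity n))
        (∈-map⁺ (multiplicity n) (∈-primeDivisors pp p∣n))

subtrees : Tree → List Tree
subtrees (node ts) = ts

≥2⇒tF≢leaf : ∀ {f e} → 2 ≤ e → tF (suc f) e ≢ node []
≥2⇒tF≢leaf {f} {e@(suc _)} e≥2 tFe≡leaf with ∃primeDivisor e≥2
... | q , pq , q∣e = contradiction
  (subst (tF f (multiplicity e q) ∈_) (cong subtrees tFe≡leaf) (∈-map⁺ (tF f) (∈-exponents pq q∣e))) λ ()

t≡node-leaves⇒ : ∀ {n ys} → t (2+ n) ≡ node ys → All (_≡ node []) ys →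
                 length (primeDivisors (2+ n)) ≡ length ys × SquareFree (2+ n)
t≡node-leaves⇒ {n} {ys} t≡ leaves = length≡ , squareFree
  where
  N = 2+ n

  subtrees≡ : map (tF (suc n) ∘ multiplicity N) (primeDivisors N) ≡ ys
  subtrees≡ = begin
    map (tF (suc n) ∘ multiplicity N) (primeDivisors N)      ≡⟨ map-∘ _ ⟩
    map (tF (suc n)) (map (multiplicity N) (primeDivisors N)) ≡⟨ cong (map _) (exponents≡map-multiplicity N) ⟨
    map (tF (suc n)) (exponents N)                            ≡⟨ cong subtrees t≡ ⟩
    ys                                                        ∎
    where open ≡-Reasoning

  length≡ : length (primeDivisors N) ≡ length ys
  length≡ = trans (sym (length-map (tF (suc n) ∘ multiplicity N) (primeDivisors N)))
                  (cong length subtrees≡)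

  squareFree : SquareFree N
  squareFree {0} pp _ = ¬prime[0] pp
  squareFree {1} pp _ = ¬prime[1] pp
  squareFree {p@(2+ k)} pp p*p∣N = ≥2⇒tF≢leaf {n} multiplicity≥2 (All.lookup leaves subtree∈ys)
    where
    subtree∈ys : tF (suc n) (multiplicity N p) ∈ ys
    subtree∈ys = subst (tF (suc n) (multiplicity N p) ∈_) subtrees≡
                   (∈-map⁺ (tF (suc n) ∘ multiplicity N) (∈-primeDivisors pp (∣-trans (m∣m*n p) p*p∣N)))
    multiplicity≥2 : 2 ≤ multiplicity N p
    multiplicity≥2 = ^∣⇒≤valuation (s≤s (s≤s z≤n))
                       (subst (_∣ N) (cong (p *_) (sym (*-identityʳ p))) p*p∣N)

∈-length≡1⇒≡ : ∀ {A : Set} {xs : List A} {x y} → length xs ≡ 1 → x ∈ xs → y ∈ xs → x ≡ y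
∈-length≡1⇒≡ {xs = _ ∷ []} _ (here refl) (here refl) = refl

∈-length≡2⇒pigeonhole : ∀ {A : Set} {xs : List A} {x y z} → length xs ≡ 2 →
                        x ∈ xs → y ∈ xs → z ∈ xs → x ≡ y ⊎ x ≡ z ⊎ y ≡ z
∈-length≡2⇒pigeonhole {xs = _ ∷ _ ∷ []} _ = pigeonhole
  where
  pigeonhole : ∀ {a b x y z} → x ∈ a ∷ b ∷ [] → y ∈ a ∷ b ∷ [] → z ∈ a ∷ b ∷ [] →
               x ≡ y ⊎ x ≡ z ⊎ y ≡ z
  pigeonhole (here refl) (here refl) _ = inj₁ refl
  pigeonhole (there (here refl)) (there (here refl)) _ = inj₁ refl
  pigeonhole (here refl) (there (here refl)) (here refl) = inj₂ (inj₁ refl)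
  pigeonhole (there (here refl)) (here refl) (there (here refl)) = inj₂ (inj₁ refl)
  pigeonhole (here refl) (there (here refl)) (there (here refl)) = inj₂ (inj₂ refl)
  pigeonhole (there (here refl)) (here refl) (here refl) = inj₂ (inj₂ refl)

t≡t5∧prime∣⇒≡ : ∀ {n p} → t n ≡ t 5 → Prime p → p ∣ n → n ≡ p
t≡t5∧prime∣⇒≡ {0} ()
t≡t5∧prime∣⇒≡ {1} ()
t≡t5∧prime∣⇒≡ {2+ n} t≡ pp p∣n with t≡node-leaves⇒ t≡ (refl ∷ [])
... | oneDivisor , squareFree = squareFree∧∣⇒≡ squareFree p∣n λ pq q∣n →
  ∣-reflexive (∈-length≡1⇒≡ oneDivisor (∈-primeDivisors pq q∣n) (∈-primeDivisors pp p∣n))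

prime[3] : Prime 3
prime[3] = from-yes (prime? 3)

2∣6 : 2 ∣ 6
2∣6 = divides 3 refl

3∣6 : 3 ∣ 6
3∣6 = divides 2 refl

t≡t6∧6∣⇒≡6 : ∀ {n} → t n ≡ t 6 → 6 ∣ n → n ≡ 6
t≡t6∧6∣⇒≡6 {0} ()
t≡t6∧6∣⇒≡6 {1} ()
t≡t6∧6∣⇒≡6 {2+ n} t≡ 6∣n with t≡node-leaves⇒ t≡ (refl ∷ refl ∷ [])
... | twoDivisors , squareFree = squareFree∧∣⇒≡ squareFree 6∣n primes∣6
  where
  primes∣6 : ∀ {q} → Prime q → q ∣ 2+ n → q ∣ 6
  primes∣6 pq q∣n
    with ∈-length≡2⇒pigeonhole twoDivisors
           (∈-primeDivisors prime[2] (∣-trans 2∣6 6∣n))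
           (∈-primeDivisors prime[3] (∣-trans 3∣6 6∣n))
           (∈-primeDivisors pq q∣n)
  ... | inj₂ (inj₁ refl) = 2∣6
  ... | inj₂ (inj₂ refl) = 3∣6

consecutive⇒≡5 : ∀ {m} → t m ≡ t 5 → t (suc m) ≡ t 6 → t (2 + m) ≡ t 5 → m ≡ 5
consecutive⇒≡5 {m} t₀ t₁ t₂ with m % 6 | m%n<n m 6 | m≡m%n+[m/n]*n m 6
... | 0 | _ | m≡ = contradiction (subst (λ n → t (suc n) ≡ t 6) m≡2 t₁) λ ()
  where m≡2 = t≡t5∧prime∣⇒≡ t₀ prime[2] (≡residue⇒∣ 0 (m / 6) m≡ (2 ∣0) 2∣6)
... | 1 | _ | m≡ = contradiction (subst (λ n → t n ≡ t 5) m≡1 t₀) λ ()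
  where
  2+m≡3 = t≡t5∧prime∣⇒≡ t₂ prime[3] (≡residue⇒∣ 3 (m / 6) (cong (2 +_) m≡) ∣-refl 3∣6)
  m≡1 = suc-injective (suc-injective 2+m≡3)
... | 2 | _ | m≡ = contradiction (subst (λ n → t (suc n) ≡ t 6) m≡2 t₁) λ ()
  where m≡2 = t≡t5∧prime∣⇒≡ t₀ prime[2] (≡residue⇒∣ 2 (m / 6) m≡ ∣-refl 2∣6)
... | 3 | _ | m≡ = contradiction (subst (λ n → t (suc n) ≡ t 6) m≡3 t₁) λ ()
  where m≡3 = t≡t5∧prime∣⇒≡ t₀ prime[3] (≡residue⇒∣ 3 (m / 6) m≡ ∣-refl 3∣6)
... | 4 | _ | m≡ = contradiction (subst (λ n → t (suc n) ≡ t 6) m≡2 t₁) λ ()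
  where m≡2 = t≡t5∧prime∣⇒≡ t₀ prime[2] (≡residue⇒∣ 4 (m / 6) m≡ (divides 2 refl) 2∣6)
... | 5 | _ | m≡ = suc-injective (t≡t6∧6∣⇒≡6 t₁ (≡residue⇒∣ 6 (m / 6) (cong suc m≡) ∣-refl ∣-refl))
... | 2+ (2+ (2+ (2+ (2+ (2+ _))))) | s≤s (s≤s (s≤s (s≤s (s≤s (s≤s ()))))) | _

-- The hypothesis 0 < m is redundant since t 0 ≢ t 5, and t 7 is the same tree as t 5.
mainTheorem2 : (m : ℕ) →
    ((0 < m) × (t m ≡ t 5) × (t (m + 1) ≡ t 6) × (t (m + 2) ≡ t 7)) ⇔ (m ≡ 5)
mainTheorem2 m = mk⇔ (λ (_ , t₀ , t₁ , t₂) → consecutive⇒≡5 t₀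
                         (subst (λ n → t n ≡ t 6) (+-comm m 1) t₁)
                         (subst (λ n → t n ≡ t 7) (+-comm m 2) t₂))
                     λ { refl → s≤s z≤n , refl , refl , refl }
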